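{- Let $n\geq 4$ be an integer and let $LG_n^C$ be the complement of the Ladder graph $LG_n = P_2\,\square\, P_n$. Then $\gamma_{SR}(LG_n^C) = 2$.
   Context: All graphs are finite, simple and undirected. For a vertex $u$ of a graph $G$, $N_G[u]$ denotes the closed neighbourhood of $u$ (the vertex $u$ together with all vertices adjacent to $u$). A signed Roman dominating function (SRDF) on $G$ is a function $f: V(G)\to\{ -1,1,2\}$ such that (i) $\sum_{v\in N_G[u]} f(v)\geq 1$ for every $u\in V(G)$, and (ii) every vertex $u$ with $f(u)=-1$ is adjacent to at least one vertex $v$ with $f(v)=2$. The weight of $f$ is $w(f)=\sum_{u\in V(G)} f(u)$, and the signed Roman domination number $\gamma_{SR}(G)$ is the minimum weight of an SRDF on $G$. The Ladder graph $LG_n$ has vertex set $\{(1,i),(2,i): 1\le i\le n\}$ and edges $\{(1,i),(2,i)\}$ for $1\le i\le n$, and $\{(1,i),(1,i+1)\}$, $\{(2,i),(2,i+1)\}$ for $1\le i\le n-1$. The complement $G^C$ of a graph $G$ has the same vertex set, with distinct $u,v$ adjacent in $G^C$ iff they are not adjacent in $G$. -}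

module Defs where

open import Data.Nat using (ℕ; zero; suc; _+_)
open import Data.Integer using (ℤ; +_; -[1+_]) renaming (_+_ to _+ℤ_; _≤_ to _≤ℤ_)
open import Data.Fin using (Fin; zero; suc; toℕ)
open import Data.Bool using (Bool; true; false; not; _∧_; _∨_; if_then_else_)
open import Data.List using (List; []; _∷_; map; foldr; filter; concatMap; allFin)
open import Data.Product using (_×_; _,_; proj₁; proj₂; Σ; ∃)
open import Data.List.Relation.Unary.Any using (Any)
open import Relation.Binary.PropositionalEquality using (_≡_)
open import Relation.Nullary.Decidable using (⌊_⌋)
import Data.Nat as N
import Data.Fin as F

-- A finite graph: a vertex type with an explicit finite enumeration
-- (each vertex listed exactly once) and a Boolean adjacency. Only used for the
-- concrete (simple) graphs LG_n and LG_n^C below.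
record FinGraph : Set₁ where
  field
    V        : Set
    vertices : List V
    adj      : V → V → Bool

open FinGraph public

complementWith : (G : FinGraph) → (V G → V G → Bool) → FinGraph
complementWith G eq = record
  { V = V G
  ; vertices = vertices G
  ; adj = λ u v → not (eq u v) ∧ not (adj G u v)
  }

-- Ladder graph LG_n: vertices (r , i) with r ∈ Fin 2 (row 1/2), i ∈ Fin n (column 1..n).
ladderVertices : (n : ℕ) → List (Fin 2 × Fin n)
ladderVertices n = concatMap (λ r → map (λ i → (r , i)) (allFin n)) (allFin 2)

eqFin : {m : ℕ} → Fin m → Fin m → Bool
eqFin a b = ⌊ a F.≟ b ⌋

consecutive : {n : ℕ} → Fin n → Fin n → Bool
consecutive i j = ⌊ suc (toℕ i) N.≟ toℕ j ⌋ ∨ ⌊ suc (toℕ j) N.≟ toℕ i ⌋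

ladderAdj : {n : ℕ} → Fin 2 × Fin n → Fin 2 × Fin n → Bool
ladderAdj (r , i) (s , j) =
  (not (eqFin r s) ∧ eqFin i j) ∨ (eqFin r s ∧ consecutive i j)

eqVert : {n : ℕ} → Fin 2 × Fin n → Fin 2 × Fin n → Bool
eqVert (r , i) (s , j) = eqFin r s ∧ eqFin i j

Ladder : ℕ → FinGraph
Ladder n = record { V = Fin 2 × Fin n ; vertices = ladderVertices n ; adj = ladderAdj }

LadderC : ℕ → FinGraph
LadderC n = complementWith (Ladder n) eqVert

data Label : Set where
  m1 one two : Label

val : Label → ℤ
val m1  = -[1+ 0 ]
val one = + 1
val two = + 2

sumℤ : List ℤ → ℤ
sumℤ = foldr _+ℤ_ (+ 0)

inClosedNbhd : (G : FinGraph) → (V G → V G → Bool) → V G → V G → Bool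
inClosedNbhd G eq u v = eq u v ∨ adj G u v

nbhdSum : (G : FinGraph) → (V G → V G → Bool) → (V G → Label) → V G → ℤ
nbhdSum G eq f u =
  sumℤ (map (λ v → if inClosedNbhd G eq u v then val (f v) else + 0) (vertices G))

weight : (G : FinGraph) → (V G → Label) → ℤ
weight G f = sumℤ (map (λ v → val (f v)) (vertices G))

record IsSRDF (G : FinGraph) (eq : V G → V G → Bool) (f : V G → Label) : Set where
  field
    nbhd-cond : ∀ u → + 1 ≤ℤ nbhdSum G eq f u
    m1-cond   : ∀ u → f u ≡ m1 → ∃ λ v → adj G u v ≡ true × f v ≡ two

IsSRDomNumber : (G : FinGraph) → (V G → V G → Bool) → ℤ → Set
IsSRDomNumber G eq k =
  (Σ (V G → Label) λ f → IsSRDF G eq f × weight G f ≡ k)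
  × (∀ f → IsSRDF G eq f → k ≤ℤ weight G f)

-- In the complement of the ladder, the closed neighbourhood of u is every vertex except the
-- ladder neighbours of u, so condition (i) says that f summed over the ladder neighbourhood
-- of u is at most w(f) - 1. Adding this for the two vertices of column a bounds the window
-- c(a-1) + c(a) + c(a+1) of column sums by 2w(f) - 2. If w(f) ≤ 1 this bound is ≤ 0, and
-- splitting the columns into disjoint windows gives w(f) ≤ 2w(f) - 2, so w(f) ≥ 2 after all.
-- Weight 2 is attained by the rows 2,-1,-1,1 / 2,-1,-1,1 for n = 4 and by the rows
-- 2,-1,-1,1,-1,1,1,… / 1,-1,1,2,-1,-1,-1,… for n ≥ 5.
module Submission where

open import Defs
import Data.Integer.Properties as ℤ
open import Algebra.Properties.CommutativeMonoid.Sum ℤ.+-0-commutativeMonoid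
  using (sum-syntax; sum-cong-≗; sum-replicate-zero; ∑-distrib-+)
open import Data.Bool using (Bool; true; false; _∧_; _∨_; if_then_else_)
open import Data.Bool.Properties using (∨-identityʳ; ∧-zeroʳ)
open import Data.Empty using (⊥-elim)
open import Data.Fin using (Fin; zero; suc; toℕ; fromℕ<; opposite)
import Data.Fin as Fin
open import Data.Fin.Properties using (toℕ<n; toℕ-fromℕ<)
open import Data.Integer using (ℤ; +_; -[1+_]; _+_; _-_) renaming (_≤_ to _≤ℤ_)
open import Data.Integer.Tactic.RingSolver using (solve-∀)
open import Data.List using (List; []; _∷_; _++_; map; tabulate)
open import Data.List.Properties using (map-tabulate; map-cong; ++-identityʳ)
import Data.Nat as ℕ
open import Data.Nat using (ℕ; zero; suc; _≡ᵇ_; _<_; _≤_; _≥_; _*_; z≤n; s≤s; s≤s⁻¹)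
open import Data.Nat.Properties
  using (1+n≢n; ≮⇒≥; ≤-refl; ≤-trans; <-trans; n<1+n; m+n≤o⇒m≤o; m≤n⇒m≤1+n; *-monoˡ-≤)
open import Data.Product using (_×_; _,_; ∃; Σ)
open import Data.Sum using (_⊎_; inj₁; inj₂)
open import Function using (_∘_)
open import Relation.Binary.PropositionalEquality
  using (_≡_; refl; sym; trans; cong; cong₂; subst; subst₂; module ≡-Reasoning)
open import Relation.Nullary.Decidable using (yes; no; isYes≗does; ⌊⌋-map′)

infixr 7 [_]·_

[_]·_ : Bool → ℤ → ℤ
[ b ]· x = if b then x else + 0

[∨]·-split : ∀ a b x → a ∧ b ≡ false → [ a ∨ b ]· x ≡ [ a ]· x + [ b ]· x
[∨]·-split true  false x _ = sym (ℤ.+-identityʳ x)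
[∨]·-split false true  x _ = sym (ℤ.+-identityˡ x)
[∨]·-split false false x _ = refl

sumℤ-map-++ : ∀ {A : Set} (h : A → ℤ) xs ys →
              sumℤ (map h (xs ++ ys)) ≡ sumℤ (map h xs) + sumℤ (map h ys)
sumℤ-map-++ h []       ys = sym (ℤ.+-identityˡ _)
sumℤ-map-++ h (x ∷ xs) ys =
  trans (cong (_+_ (h x)) (sumℤ-map-++ h xs ys)) (sym (ℤ.+-assoc (h x) _ _))

sumℤ-map-− : ∀ {A : Set} (a b : A → ℤ) xs →
             sumℤ (map (λ x → a x - b x) xs) ≡ sumℤ (map a xs) - sumℤ (map b xs)
sumℤ-map-− a b []       = refl
sumℤ-map-− a b (x ∷ xs) =
  trans (cong (_+_ (a x - b x)) (sumℤ-map-− a b xs)) (interchange (a x) (b x) _ _)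
  where
  interchange : ∀ p q s t → (p - q) + (s - t) ≡ (p + s) - (q + t)
  interchange = solve-∀

sumℤ-map-tabulate : ∀ {A : Set} {n} (h : A → ℤ) (g : Fin n → A) →
                    sumℤ (map h (tabulate g)) ≡ ∑[ i < n ] h (g i)
sumℤ-map-tabulate {n = zero}  h g = refl
sumℤ-map-tabulate {n = suc n} h g = cong (_+_ (h (g zero))) (sumℤ-map-tabulate h (g ∘ suc))

sumBelow : ℕ → (ℕ → ℤ) → ℤ
sumBelow n φ = ∑[ j < n ] φ (toℕ j)

sumBelow-suc : ∀ n φ → sumBelow (suc n) φ ≡ sumBelow n φ + φ n
sumBelow-suc zero    φ = trans (ℤ.+-identityʳ (φ 0)) (sym (ℤ.+-identityˡ (φ 0)))
sumBelow-suc (suc n) φ =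
  trans (cong (_+_ (φ 0)) (sumBelow-suc n (φ ∘ suc))) (sym (ℤ.+-assoc (φ 0) _ _))

prev : (ℕ → ℤ) → ℕ → ℤ
prev φ zero    = + 0
prev φ (suc k) = φ k

prev-+ : ∀ (φ ψ : ℕ → ℤ) k → prev (λ j → φ j + ψ j) k ≡ prev φ k + prev ψ k
prev-+ φ ψ zero    = refl
prev-+ φ ψ (suc k) = refl

sumBelow-prev : ∀ n φ → sumBelow (suc n) (prev φ) ≡ sumBelow n φ
sumBelow-prev n φ = ℤ.+-identityˡ (sumBelow n φ)

pad : ∀ {n} → (Fin n → ℤ) → ℕ → ℤ
pad {zero}  h k       = + 0
pad {suc n} h zero    = h zero
pad {suc n} h (suc k) = pad (h ∘ suc) k

pad-toℕ : ∀ {n} (h : Fin n → ℤ) i → pad h (toℕ i) ≡ h i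
pad-toℕ h zero    = refl
pad-toℕ h (suc i) = pad-toℕ (h ∘ suc) i

pad-≥ : ∀ {n} (h : Fin n → ℤ) k → n ≤ k → pad h k ≡ + 0
pad-≥ {zero}  h k       _         = refl
pad-≥ {suc n} h (suc k) (s≤s n≤k) = pad-≥ (h ∘ suc) k n≤k

pad-∘toℕ : ∀ {n} (φ : ℕ → ℤ) k → k < n → pad {n} (φ ∘ toℕ) k ≡ φ k
pad-∘toℕ {suc n} φ zero    _         = refl
pad-∘toℕ {suc n} φ (suc k) (s≤s k<n) = pad-∘toℕ (φ ∘ suc) k k<n

∑-pad : ∀ {n} (h : Fin n → ℤ) → ∑[ j < n ] h j ≡ sumBelow n (pad h)
∑-pad h = sum-cong-≗ (λ j → sym (pad-toℕ h j))

∑-select : ∀ {n} (h : Fin n → ℤ) c → ∑[ j < n ] ([ c ≡ᵇ toℕ j ]· h j) ≡ pad h c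
∑-select {zero}  h c       = refl
∑-select {suc n} h zero    = trans (cong (_+_ (h zero)) (sum-replicate-zero n)) (ℤ.+-identityʳ _)
∑-select {suc n} h (suc c) = trans (ℤ.+-identityˡ _) (∑-select (h ∘ suc) c)

∑-select-prev : ∀ {n} (h : Fin n → ℤ) c → ∑[ j < n ] ([ suc (toℕ j) ≡ᵇ c ]· h j) ≡ prev (pad h) c
∑-select-prev {n}     h zero          = sum-replicate-zero n
∑-select-prev {zero}  h (suc c)       = refl
∑-select-prev {suc n} h (suc zero)    =
  trans (cong (_+_ (h zero)) (sum-replicate-zero n)) (ℤ.+-identityʳ _)
∑-select-prev {suc n} h (suc (suc c)) = trans (ℤ.+-identityˡ _) (∑-select-prev (h ∘ suc) (suc c))

∑-select-Fin : ∀ {n} (h : Fin n → ℤ) i → ∑[ j < n ] ([ eqFin i j ]· h j) ≡ h i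
∑-select-Fin {suc n} h zero    = trans (cong (_+_ (h zero)) (sum-replicate-zero n)) (ℤ.+-identityʳ _)
∑-select-Fin {suc n} h (suc i) = begin
  + 0 + ∑[ j < n ] ([ eqFin (suc i) (suc j) ]· h (suc j))
    ≡⟨ ℤ.+-identityˡ _ ⟩
  ∑[ j < n ] ([ eqFin (suc i) (suc j) ]· h (suc j))
    ≡⟨ sum-cong-≗ (λ j → cong ([_]· h (suc j)) (⌊⌋-map′ _ _ (i Fin.≟ j))) ⟩
  ∑[ j < n ] ([ eqFin i j ]· h (suc j))
    ≡⟨ ∑-select-Fin (h ∘ suc) i ⟩
  h (suc i) ∎
  where open ≡-Reasoning

suc-≡ᵇ-exclusive : ∀ i k → (suc i ≡ᵇ k) ∧ (suc k ≡ᵇ i) ≡ false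
suc-≡ᵇ-exclusive zero    k       = ∧-zeroʳ _
suc-≡ᵇ-exclusive (suc i) zero    = refl
suc-≡ᵇ-exclusive (suc i) (suc k) = suc-≡ᵇ-exclusive i k

consecutive-≡ᵇ : ∀ {n} (i j : Fin n) →
                 consecutive i j ≡ (suc (toℕ i) ≡ᵇ toℕ j) ∨ (suc (toℕ j) ≡ᵇ toℕ i)
consecutive-≡ᵇ i j =
  cong₂ _∨_ (isYes≗does (suc (toℕ i) ℕ.≟ toℕ j)) (isYes≗does (suc (toℕ j) ℕ.≟ toℕ i))

consecutive-irrefl : ∀ {n} (i : Fin n) → consecutive i i ≡ false
consecutive-irrefl i with suc (toℕ i) ℕ.≟ toℕ i
... | yes 1+i≡i = ⊥-elim (1+n≢n 1+i≡i)
... | no  _     = refl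

∑-consecutive : ∀ {n} (h : Fin n → ℤ) i →
                ∑[ j < n ] ([ consecutive i j ]· h j) ≡ pad h (suc (toℕ i)) + prev (pad h) (toℕ i)
∑-consecutive {n} h i = begin
  ∑[ j < n ] ([ consecutive i j ]· h j)
    ≡⟨ sum-cong-≗ split ⟩
  ∑[ j < n ] ([ next j ]· h j + [ previous j ]· h j)
    ≡⟨ ∑-distrib-+ (λ j → [ next j ]· h j) (λ j → [ previous j ]· h j) ⟩
  ∑[ j < n ] ([ next j ]· h j) + ∑[ j < n ] ([ previous j ]· h j)
    ≡⟨ cong₂ _+_ (∑-select h (suc (toℕ i))) (∑-select-prev h (toℕ i)) ⟩
  pad h (suc (toℕ i)) + prev (pad h) (toℕ i) ∎
  where
  open ≡-Reasoning
  next previous : Fin n → Bool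
  next     j = suc (toℕ i) ≡ᵇ toℕ j
  previous j = suc (toℕ j) ≡ᵇ toℕ i
  split : ∀ j → [ consecutive i j ]· h j ≡ [ next j ]· h j + [ previous j ]· h j
  split j = trans (cong ([_]· h j) (consecutive-≡ᵇ i j))
                  ([∨]·-split (next j) (previous j) (h j) (suc-≡ᵇ-exclusive (toℕ i) (toℕ j)))

openNbhdSum : (G : FinGraph) → (V G → Label) → V G → ℤ
openNbhdSum G f u = sumℤ (map (λ v → [ adj G u v ]· val (f v)) (vertices G))

Loopless : (G : FinGraph) → (V G → V G → Bool) → Set
Loopless G eq = ∀ u v → eq u v ≡ true → adj G u v ≡ false

nbhdSum-complementWith : ∀ G eq → Loopless G eq → ∀ f u →
  nbhdSum (complementWith G eq) eq f u ≡ weight G f - openNbhdSum G f u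
nbhdSum-complementWith G eq loopless f u =
  trans (cong sumℤ (map-cong pointwise (vertices G))) (sumℤ-map-− _ _ (vertices G))
  where
  pointwise : ∀ v → [ inClosedNbhd (complementWith G eq) eq u v ]· val (f v)
                    ≡ val (f v) - [ adj G u v ]· val (f v)
  pointwise v with eq u v in u≡v | adj G u v in u~v
  ... | true  | true  with () ← trans (sym (loopless u v u≡v)) u~v
  ... | true  | false = sym (ℤ.+-identityʳ (val (f v)))
  ... | false | true  = sym (ℤ.+-inverseʳ (val (f v)))
  ... | false | false = sym (ℤ.+-identityʳ (val (f v)))

complementWith-nbhd-cond : ∀ G eq → Loopless G eq → ∀ f → weight G f ≡ + 2 →
  ∀ u → openNbhdSum G f u ≤ℤ + 1 → + 1 ≤ℤ nbhdSum (complementWith G eq) eq f u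
complementWith-nbhd-cond G eq loopless f w≡2 u sum≤1
  rewrite nbhdSum-complementWith G eq loopless f u | w≡2 = ℤ.+-monoʳ-≤ (+ 2) (ℤ.neg-mono-≤ sum≤1)

ladderAdj-sameRow : ∀ {n} r (i j : Fin n) → ladderAdj (r , i) (r , j) ≡ consecutive i j
ladderAdj-sameRow zero       i j = refl
ladderAdj-sameRow (suc zero) i j = refl

ladderAdj-oppositeRow : ∀ {n} r (i j : Fin n) → ladderAdj (r , i) (opposite r , j) ≡ eqFin i j
ladderAdj-oppositeRow zero       i j = ∨-identityʳ _
ladderAdj-oppositeRow (suc zero) i j = ∨-identityʳ _

eqVert-sound : ∀ {n} (u v : Fin 2 × Fin n) → eqVert u v ≡ true → u ≡ v
eqVert-sound (r , i) (s , j) _ with r Fin.≟ s | i Fin.≟ j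
eqVert-sound (r , i) (r , i) _ | yes refl | yes refl = refl

Ladder-loopless : ∀ {n} → Loopless (Ladder n) eqVert
Ladder-loopless (r , i) v u≡v with refl ← eqVert-sound (r , i) v u≡v =
  trans (ladderAdj-sameRow r i i) (consecutive-irrefl i)

sum-ladderVertices : ∀ {n} (h : Fin 2 × Fin n → ℤ) →
  sumℤ (map h (ladderVertices n)) ≡ ∑[ j < n ] h (zero , j) + ∑[ j < n ] h (suc zero , j)
sum-ladderVertices {n} h =
  trans (sumℤ-map-++ h (rowVertices zero) (rowVertices (suc zero) ++ []))
        (cong₂ _+_ (sum-row zero)
                   (trans (cong (sumℤ ∘ map h) (++-identityʳ (rowVertices (suc zero)))) (sum-row (suc zero))))
  where
  rowVertices : Fin 2 → List (Fin 2 × Fin n)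
  rowVertices r = map (r ,_) (tabulate (λ j → j))
  sum-row : ∀ r → sumℤ (map h (rowVertices r)) ≡ ∑[ j < n ] h (r , j)
  sum-row r = trans (cong (sumℤ ∘ map h) (map-tabulate (λ j → j) (r ,_))) (sumℤ-map-tabulate h (r ,_))

row : ∀ {n} → (Fin 2 × Fin n → Label) → Fin 2 → ℕ → ℤ
row f r = pad (λ j → val (f (r , j)))

column : ∀ {n} → (Fin 2 × Fin n → Label) → ℕ → ℤ
column f k = row f zero k + row f (suc zero) k

column-≥ : ∀ {n} (f : Fin 2 × Fin n → Label) k → n ≤ k → column f k ≡ + 0
column-≥ f k n≤k = cong₂ _+_ (pad-≥ _ k n≤k) (pad-≥ _ k n≤k)

weight-Ladder : ∀ {n} (f : Fin 2 × Fin n → Label) → weight (Ladder n) f ≡ sumBelow n (column f)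
weight-Ladder {n} f =
  trans (sum-ladderVertices (λ v → val (f v)))
        (trans (cong₂ _+_ (∑-pad (λ j → val (f (zero , j)))) (∑-pad (λ j → val (f (suc zero , j)))))
               (sym (∑-distrib-+ {n} (λ j → row f zero (toℕ j)) (λ j → row f (suc zero) (toℕ j)))))

∑-sameRow : ∀ {n} (f : Fin 2 × Fin n → Label) r i →
  ∑[ j < n ] ([ ladderAdj (r , i) (r , j) ]· val (f (r , j))) ≡ row f r (suc (toℕ i)) + prev (row f r) (toℕ i)
∑-sameRow f r i =
  trans (sum-cong-≗ λ j → cong ([_]· val (f (r , j))) (ladderAdj-sameRow r i j))
        (∑-consecutive (λ j → val (f (r , j))) i)

∑-oppositeRow : ∀ {n} (f : Fin 2 × Fin n → Label) r i →
  ∑[ j < n ] ([ ladderAdj (r , i) (opposite r , j) ]· val (f (opposite r , j))) ≡ row f (opposite r) (toℕ i)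
∑-oppositeRow f r i =
  trans (sum-cong-≗ λ j → cong ([_]· val (f (opposite r , j))) (ladderAdj-oppositeRow r i j))
        (trans (∑-select-Fin (λ j → val (f (opposite r , j))) i) (sym (pad-toℕ _ i)))

openNbhdSum-Ladder : ∀ {n} (f : Fin 2 × Fin n → Label) r i →
  openNbhdSum (Ladder n) f (r , i)
  ≡ row f r (suc (toℕ i)) + prev (row f r) (toℕ i) + row f (opposite r) (toℕ i)
openNbhdSum-Ladder f zero i =
  trans (sum-ladderVertices (λ v → [ ladderAdj (zero , i) v ]· val (f v)))
        (cong₂ _+_ (∑-sameRow f zero i) (∑-oppositeRow f zero i))
openNbhdSum-Ladder f (suc zero) i =
  trans (sum-ladderVertices (λ v → [ ladderAdj (suc zero , i) v ]· val (f v)))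
        (trans (cong₂ _+_ (∑-oppositeRow f (suc zero) i) (∑-sameRow f (suc zero) i))
               (ℤ.+-comm (row f zero (toℕ i)) _))

block : (ℕ → ℤ) → ℕ → ℤ
block φ a = φ a + φ (suc a) + φ (suc (suc a))

window : (ℕ → ℤ) → ℕ → ℤ
window c a = prev c a + c a + c (suc a)

openNbhdSum-column : ∀ {n} (f : Fin 2 × Fin n → Label) i →
  openNbhdSum (Ladder n) f (zero , i) + openNbhdSum (Ladder n) f (suc zero , i) ≡ window (column f) (toℕ i)
openNbhdSum-column f i = begin
  openNbhdSum (Ladder _) f (zero , i) + openNbhdSum (Ladder _) f (suc zero , i)
    ≡⟨ cong₂ _+_ (openNbhdSum-Ladder f zero i) (openNbhdSum-Ladder f (suc zero) i) ⟩
  (r₀ (suc a) + prev r₀ a + r₁ a) + (r₁ (suc a) + prev r₁ a + r₀ a)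
    ≡⟨ regroup (r₀ (suc a)) (prev r₀ a) (r₁ a) (r₁ (suc a)) (prev r₁ a) (r₀ a) ⟩
  (prev r₀ a + prev r₁ a) + column f a + column f (suc a)
    ≡⟨ cong (λ p → p + column f a + column f (suc a)) (sym (prev-+ r₀ r₁ a)) ⟩
  window (column f) a ∎
  where
  open ≡-Reasoning
  a = toℕ i
  r₀ = row f zero
  r₁ = row f (suc zero)
  regroup : ∀ x₀ p₀ y₁ x₁ p₁ y₀ →
            (x₀ + p₀ + y₁) + (x₁ + p₁ + y₀) ≡ (p₀ + p₁) + (y₀ + y₁) + (x₀ + x₁)
  regroup = solve-∀

sumBelow-3+ : ∀ m φ → sumBelow (3 ℕ.+ m) φ ≡ block φ 0 + sumBelow m (λ k → φ (3 ℕ.+ k))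
sumBelow-3+ m φ = regroup (φ 0) (φ 1) (φ 2) _
  where
  regroup : ∀ a b c s → a + (b + (c + s)) ≡ a + b + c + s
  regroup = solve-∀

sumBelow-blocks-nonpos : ∀ k φ → (∀ t → t < k → block φ (t * 3) ≤ℤ + 0) →
                         sumBelow (k * 3) φ ≤ℤ + 0
sumBelow-blocks-nonpos zero    φ _       = ℤ.≤-refl
sumBelow-blocks-nonpos (suc k) φ blocks≤ =
  subst (_≤ℤ + 0) (sym (sumBelow-3+ (k * 3) φ))
        (ℤ.+-mono-≤ (blocks≤ 0 (s≤s z≤n))
                    (sumBelow-blocks-nonpos k (λ j → φ (3 ℕ.+ j)) (λ t t<k → blocks≤ (suc t) (s≤s t<k))))

sumBelow-blocks : ∀ k φ {B} → B ≤ℤ + 0 → (∀ t → t ≤ k → block φ (t * 3) ≤ℤ B) →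
                  sumBelow (suc k * 3) φ ≤ℤ B
sumBelow-blocks k φ {B} B≤0 blocks≤ =
  subst₂ _≤ℤ_ (sym (sumBelow-3+ (k * 3) φ)) (ℤ.+-identityʳ B)
         (ℤ.+-mono-≤ (blocks≤ 0 z≤n)
                     (sumBelow-blocks-nonpos k (λ j → φ (3 ℕ.+ j))
                                             (λ t t<k → ℤ.≤-trans (blocks≤ (suc t) t<k) B≤0)))

near-multiple-of-3 : ∀ n → ∃ λ k →
  suc n ≡ suc k * 3 ⊎ suc (suc n) ≡ suc k * 3 ⊎ suc (suc (suc n)) ≡ suc k * 3
near-multiple-of-3 0 = 0 , inj₂ (inj₂ refl)
near-multiple-of-3 1 = 0 , inj₂ (inj₁ refl)
near-multiple-of-3 2 = 0 , inj₁ refl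
near-multiple-of-3 (suc (suc (suc n))) with near-multiple-of-3 n
... | k , inj₁ eq        = suc k , inj₁ (cong (3 ℕ.+_) eq)
... | k , inj₂ (inj₁ eq) = suc k , inj₂ (inj₁ (cong (3 ℕ.+_) eq))
... | k , inj₂ (inj₂ eq) = suc k , inj₂ (inj₂ (cong (3 ℕ.+_) eq))

-- The columns are cut into blocks of three after padding with at most two zero columns;
-- this works because window c (suc a) = block c a and window c a = block (prev c) a.
sumBelow-windows : ∀ n (c : ℕ → ℤ) {B} → 1 ≤ n → B ≤ℤ + 0 → c n ≡ + 0 →
                   (∀ a → a < n → window c a ≤ℤ B) → sumBelow n c ≤ℤ B
sumBelow-windows (suc n) c {B} _ B≤0 cₙ≡0 windows≤ with near-multiple-of-3 n
... | k , inj₁ refl =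
  sumBelow-blocks k c B≤0 λ t t≤k →
    windows≤ (suc (t * 3)) (s≤s (s≤s (m≤n⇒m≤1+n (*-monoˡ-≤ 3 t≤k))))
... | k , inj₂ (inj₁ refl) =
  subst (_≤ℤ B) (sumBelow-prev (suc n) c)
        (sumBelow-blocks k (prev c) B≤0 λ t t≤k →
           windows≤ (t * 3) (s≤s (m≤n⇒m≤1+n (*-monoˡ-≤ 3 t≤k))))
... | k , inj₂ (inj₂ refl) =
  subst (_≤ℤ B) (trans (sumBelow-prev (suc (suc n)) c) drop-last)
        (sumBelow-blocks k (prev c) B≤0 λ t t≤k → windows≤ (t * 3) (s≤s (*-monoˡ-≤ 3 t≤k)))
  where
  drop-last : sumBelow (suc (suc n)) c ≡ sumBelow (suc n) c
  drop-last = trans (sumBelow-suc (suc n) c)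
                    (trans (cong (_+_ (sumBelow (suc n) c)) cₙ≡0) (ℤ.+-identityʳ _))

1≤i-j⇒1≤i-k⇒j+k≤i+i-2 : ∀ {i j k} → + 1 ≤ℤ i - j → + 1 ≤ℤ i - k → j + k ≤ℤ (i + i) - + 2
1≤i-j⇒1≤i-k⇒j+k≤i+i-2 {i} {j} {k} h₁ h₂ =
  ℤ.0≤i-j⇒j≤i (subst (+ 0 ≤ℤ_) (regroup i j k)
                      (ℤ.+-mono-≤ (ℤ.i≤j⇒0≤j-i h₁) (ℤ.i≤j⇒0≤j-i h₂)))
  where
  regroup : ∀ i j k → (i - j - + 1) + (i - k - + 1) ≡ (i + i) - + 2 - (j + k)
  regroup = solve-∀

i≤i+i-2⇒2≤i : ∀ {i} → i ≤ℤ (i + i) - + 2 → + 2 ≤ℤ i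
i≤i+i-2⇒2≤i {i} h = ℤ.0≤i-j⇒j≤i (subst (+ 0 ≤ℤ_) (regroup i) (ℤ.i≤j⇒0≤j-i h))
  where
  regroup : ∀ i → (i + i) - + 2 - i ≡ i - + 2
  regroup = solve-∀

window-bound : ∀ {n} (f : Fin 2 × Fin n → Label) → IsSRDF (LadderC n) eqVert f →
  ∀ a → a < n → window (column f) a ≤ℤ (weight (Ladder n) f + weight (Ladder n) f) - + 2
window-bound {n} f srdf a a<n =
  subst (λ b → window (column f) b ≤ℤ _) (toℕ-fromℕ< a<n)
        (subst (_≤ℤ _) (openNbhdSum-column f i)
               (1≤i-j⇒1≤i-k⇒j+k≤i+i-2 {weight (Ladder n) f} (condition zero) (condition (suc zero))))
  where
  open IsSRDF srdf
  i = fromℕ< a<n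
  condition : ∀ r → + 1 ≤ℤ weight (Ladder n) f - openNbhdSum (Ladder n) f (r , i)
  condition r = subst (+ 1 ≤ℤ_) (nbhdSum-complementWith (Ladder n) eqVert Ladder-loopless f (r , i))
                      (nbhd-cond (r , i))

LadderC-weight-≥2 : ∀ n → 1 ≤ n → (f : Fin 2 × Fin n → Label) → IsSRDF (LadderC n) eqVert f →
                    + 2 ≤ℤ weight (LadderC n) f
LadderC-weight-≥2 n 1≤n f srdf with + 2 ℤ.≤? weight (Ladder n) f
... | yes 2≤W = 2≤W
... | no  2≰W = i≤i+i-2⇒2≤i W≤2W-2
  where
  W = weight (Ladder n) f
  W≤1 : W ≤ℤ + 1
  W≤1 = ℤ.i<j⇒i≤pred[j] (ℤ.≰⇒> 2≰W)
  2W-2≤0 : (W + W) - + 2 ≤ℤ + 0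
  2W-2≤0 = ℤ.i≤j⇒i-j≤0 (ℤ.+-mono-≤ W≤1 W≤1)
  W≤2W-2 : W ≤ℤ (W + W) - + 2
  W≤2W-2 = subst (_≤ℤ (W + W) - + 2) (sym (weight-Ladder f))
                 (sumBelow-windows n (column f) 1≤n 2W-2≤0 (column-≥ f n ≤-refl) (window-bound f srdf))

fourLabel : Fin 2 × Fin 4 → Label
fourLabel (_ , zero)                 = two
fourLabel (_ , suc zero)             = m1
fourLabel (_ , suc (suc zero))       = m1
fourLabel (_ , suc (suc (suc zero))) = one

fourLadder-srdf : IsSRDF (LadderC 4) eqVert fourLabel
fourLadder-srdf = record { nbhd-cond = nbhd-cond ; m1-cond = m1-cond }
  where
  nbhd-cond : ∀ u → + 1 ≤ℤ nbhdSum (LadderC 4) eqVert fourLabel u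
  nbhd-cond (zero     , zero)                 = ℤ.≤ᵇ⇒≤ _
  nbhd-cond (zero     , suc zero)             = ℤ.≤ᵇ⇒≤ _
  nbhd-cond (zero     , suc (suc zero))       = ℤ.≤ᵇ⇒≤ _
  nbhd-cond (zero     , suc (suc (suc zero))) = ℤ.≤ᵇ⇒≤ _
  nbhd-cond (suc zero , zero)                 = ℤ.≤ᵇ⇒≤ _
  nbhd-cond (suc zero , suc zero)             = ℤ.≤ᵇ⇒≤ _
  nbhd-cond (suc zero , suc (suc zero))       = ℤ.≤ᵇ⇒≤ _
  nbhd-cond (suc zero , suc (suc (suc zero))) = ℤ.≤ᵇ⇒≤ _
  m1-cond : ∀ u → fourLabel u ≡ m1 → ∃ λ v → adj (LadderC 4) u v ≡ true × fourLabel v ≡ two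
  m1-cond (_        , zero)  ()
  m1-cond (zero     , suc j) _ = (suc zero , zero) , refl , refl
  m1-cond (suc zero , suc j) _ = (zero , zero) , refl , refl

onColumns : ∀ {n} → (Fin 2 → ℕ → Label) → Fin 2 × Fin n → Label
onColumns g (r , j) = g r (toℕ j)

row-onColumns : ∀ {n} g r k → k < n → row (onColumns {n} g) r k ≡ val (g r k)
row-onColumns g r k k<n = pad-∘toℕ (λ j → val (g r j)) k k<n

prev-row-onColumns : ∀ {n} g r k → k < n → prev (row (onColumns {n} g) r) k ≡ prev (λ j → val (g r j)) k
prev-row-onColumns g r zero    _     = refl
prev-row-onColumns g r (suc k) 1+k<n = row-onColumns g r k (<-trans (n<1+n k) 1+k<n)

openNbhdSum-onColumns : ∀ {n} g r (i : Fin n) →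
  openNbhdSum (Ladder n) (onColumns g) (r , i)
  ≡ row (onColumns {n} g) r (suc (toℕ i)) + prev (λ j → val (g r j)) (toℕ i) + val (g (opposite r) (toℕ i))
openNbhdSum-onColumns {n} g r i =
  trans (openNbhdSum-Ladder (onColumns g) r i)
        (cong₂ (λ p q → row (onColumns {n} g) r (suc (toℕ i)) + p + q)
               (prev-row-onColumns g r (toℕ i) (toℕ<n i)) (row-onColumns g (opposite r) (toℕ i) (toℕ<n i)))

longLabel : Fin 2 → ℕ → Label
longLabel zero       0 = two
longLabel zero       1 = m1
longLabel zero       2 = m1
longLabel zero       3 = one
longLabel zero       4 = m1
longLabel zero       (suc (suc (suc (suc (suc _))))) = one
longLabel (suc zero) 0 = one
longLabel (suc zero) 1 = m1
longLabel (suc zero) 2 = one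
longLabel (suc zero) 3 = two
longLabel (suc zero) 4 = m1
longLabel (suc zero) (suc (suc (suc (suc (suc _))))) = m1

longLabel-interior : ∀ r k →
  val (longLabel r (suc k)) + prev (λ j → val (longLabel r j)) k + val (longLabel (opposite r) k) ≤ℤ + 1
longLabel-interior zero       0 = ℤ.≤ᵇ⇒≤ _
longLabel-interior zero       1 = ℤ.≤ᵇ⇒≤ _
longLabel-interior zero       2 = ℤ.≤ᵇ⇒≤ _
longLabel-interior zero       3 = ℤ.≤ᵇ⇒≤ _
longLabel-interior zero       4 = ℤ.≤ᵇ⇒≤ _
longLabel-interior zero       5 = ℤ.≤ᵇ⇒≤ _
longLabel-interior zero       (suc (suc (suc (suc (suc (suc _)))))) = ℤ.≤ᵇ⇒≤ _
longLabel-interior (suc zero) 0 = ℤ.≤ᵇ⇒≤ _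
longLabel-interior (suc zero) 1 = ℤ.≤ᵇ⇒≤ _
longLabel-interior (suc zero) 2 = ℤ.≤ᵇ⇒≤ _
longLabel-interior (suc zero) 3 = ℤ.≤ᵇ⇒≤ _
longLabel-interior (suc zero) 4 = ℤ.≤ᵇ⇒≤ _
longLabel-interior (suc zero) 5 = ℤ.≤ᵇ⇒≤ _
longLabel-interior (suc zero) (suc (suc (suc (suc (suc (suc _)))))) = ℤ.≤ᵇ⇒≤ _

-- Column k is the last one, so (r , k) has no right neighbour; 4 ≤ k since n ≥ 5.
longLabel-last : ∀ r k → 4 ≤ k →
  + 0 + prev (λ j → val (longLabel r j)) k + val (longLabel (opposite r) k) ≤ℤ + 1
longLabel-last _          0 ()
longLabel-last _          1 (s≤s ())
longLabel-last _          2 (s≤s (s≤s ()))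
longLabel-last _          3 (s≤s (s≤s (s≤s ())))
longLabel-last zero       4 _ = ℤ.≤ᵇ⇒≤ _
longLabel-last zero       5 _ = ℤ.≤ᵇ⇒≤ _
longLabel-last zero       (suc (suc (suc (suc (suc (suc _)))))) _ = ℤ.≤ᵇ⇒≤ _
longLabel-last (suc zero) 4 _ = ℤ.≤ᵇ⇒≤ _
longLabel-last (suc zero) 5 _ = ℤ.≤ᵇ⇒≤ _
longLabel-last (suc zero) (suc (suc (suc (suc (suc (suc _)))))) _ = ℤ.≤ᵇ⇒≤ _

longLadder-openNbhdSum : ∀ m u → openNbhdSum (Ladder (5 ℕ.+ m)) (onColumns longLabel) u ≤ℤ + 1
longLadder-openNbhdSum m (r , i) with suc (toℕ i) ℕ.<? 5 ℕ.+ m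
... | yes 1+i<n rewrite openNbhdSum-onColumns longLabel r i | row-onColumns longLabel r _ 1+i<n =
  longLabel-interior r (toℕ i)
... | no  1+i≮n rewrite openNbhdSum-onColumns longLabel r i
                      | pad-≥ (λ j → val (longLabel r (toℕ j))) _ (≮⇒≥ 1+i≮n) =
  longLabel-last r (toℕ i) (m+n≤o⇒m≤o 4 (s≤s⁻¹ (≮⇒≥ 1+i≮n)))

longLadder-weight : ∀ m → weight (Ladder (5 ℕ.+ m)) (onColumns longLabel) ≡ + 2
longLadder-weight m =
  trans (sum-ladderVertices {5 ℕ.+ m} (λ v → val (onColumns longLabel v)))
        (trans (regroup (∑[ j < m ] (+ 1)) (∑[ j < m ] -[1+ 0 ])) (cong (_+_ (+ 2)) tails-cancel))
  where
  regroup : ∀ a b → + 2 + (-[1+ 0 ] + (-[1+ 0 ] + (+ 1 + (-[1+ 0 ] + a))))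
                    + (+ 1 + (-[1+ 0 ] + (+ 1 + (+ 2 + (-[1+ 0 ] + b))))) ≡ + 2 + (a + b)
  regroup = solve-∀
  tails-cancel : ∑[ j < m ] (+ 1) + ∑[ j < m ] -[1+ 0 ] ≡ + 0
  tails-cancel = trans (sym (∑-distrib-+ {m} (λ _ → + 1) (λ _ → -[1+ 0 ]))) (sum-replicate-zero m)

longLadder-srdf : ∀ m → IsSRDF (LadderC (5 ℕ.+ m)) eqVert (onColumns longLabel)
longLadder-srdf m = record { nbhd-cond = nbhd-cond ; m1-cond = m1-cond }
  where
  nbhd-cond : ∀ u → + 1 ≤ℤ nbhdSum (LadderC (5 ℕ.+ m)) eqVert (onColumns longLabel) u
  nbhd-cond u = complementWith-nbhd-cond (Ladder (5 ℕ.+ m)) eqVert Ladder-loopless (onColumns longLabel)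
                                         (longLadder-weight m) u (longLadder-openNbhdSum m u)
  m1-cond : ∀ u → onColumns longLabel u ≡ m1 →
            ∃ λ v → adj (LadderC (5 ℕ.+ m)) u v ≡ true × onColumns longLabel v ≡ two
  m1-cond (zero     , zero)                           ()
  m1-cond (zero     , suc zero)                       _ = (suc zero , suc (suc (suc zero))) , refl , refl
  m1-cond (zero     , suc (suc zero))                 _ = (suc zero , suc (suc (suc zero))) , refl , refl
  m1-cond (zero     , suc (suc (suc zero)))           ()
  m1-cond (zero     , suc (suc (suc (suc zero))))     _ = (suc zero , suc (suc (suc zero))) , refl , refl
  m1-cond (zero     , suc (suc (suc (suc (suc _)))))  ()
  m1-cond (suc zero , zero)                           ()
  m1-cond (suc zero , suc _)                          _ = (zero , zero) , refl , refl

LadderC-srdf-of-weight-2 : ∀ n → n ≥ 4 →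
  Σ (Fin 2 × Fin n → Label) λ f → IsSRDF (LadderC n) eqVert f × weight (LadderC n) f ≡ + 2
LadderC-srdf-of-weight-2 1 (s≤s ())
LadderC-srdf-of-weight-2 2 (s≤s (s≤s ()))
LadderC-srdf-of-weight-2 3 (s≤s (s≤s (s≤s ())))
LadderC-srdf-of-weight-2 4 _ = fourLabel , fourLadder-srdf , refl
LadderC-srdf-of-weight-2 (suc (suc (suc (suc (suc m))))) _ =
  onColumns longLabel , longLadder-srdf m , longLadder-weight m

theorem2 : (n : ℕ) → n ≥ 4 → IsSRDomNumber (LadderC n) eqVert (+ 2)
theorem2 n n≥4 = LadderC-srdf-of-weight-2 n n≥4 , LadderC-weight-≥2 n (≤-trans (s≤s z≤n) n≥4)
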